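{- For all positive integers $n$ and $k$, there exists a simple $k$-latin square of order $n$ if and only if $n\geq k$.
   Context: For a positive integer $a$, $N(a)=\{1,\dots,a\}$. A $k$-latin square of order $n$ is an $n\times n$ array whose cell $(i,j)$ contains a multiset of exactly $k$ elements of $N(n)$, such that each symbol of $N(n)$ occurs exactly $k$ times (counting multiplicity) in each row and exactly $k$ times in each column. It is simple if no cell contains a repeated symbol. -}

module Defs where

open import Data.Nat using (ℕ; zero; suc; _+_)
open import Data.Fin using (Fin; zero; suc; _≟_)
open import Data.Vec using (Vec; []; _∷_; lookup)
open import Relation.Nullary using (yes; no)
open import Relation.Binary.PropositionalEquality using (_≡_)
open import Function.Definitions using (Injective)
open import Data.Product using (_×_)

-- Symbols of N(n) = {1,…,n} are represented by Fin n (symbol i+1 ↦ i).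

Σ[<_] : ∀ m → (Fin m → ℕ) → ℕ
Σ[< zero ] f = 0
Σ[< suc m ] f = f zero + Σ[< m ] (λ i → f (suc i))

-- Multiplicity of symbol s in a multiset of k symbols (listed as a vector;
-- the multiset is the vector up to reordering, and multiplicity is
-- invariant under reordering).
count : ∀ {n k} → Fin n → Vec (Fin n) k → ℕ
count s [] = 0
count s (x ∷ xs) with s ≟ x
... | yes _ = suc (count s xs)
... | no  _ = count s xs

Array : ℕ → ℕ → Set
Array n k = Fin n → Fin n → Vec (Fin n) k

IsKLatinSquare : ∀ n k → Array n k → Set
IsKLatinSquare n k L =
  (∀ (i : Fin n) (s : Fin n) → Σ[< n ] (λ j → count s (L i j)) ≡ k) ×
  (∀ (j : Fin n) (s : Fin n) → Σ[< n ] (λ i → count s (L i j)) ≡ k)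

IsSimple : ∀ n k → Array n k → Set
IsSimple n k L = ∀ (i j : Fin n) → Injective _≡_ _≡_ (lookup (L i j))

-- Necessity is immediate: a simple cell lists k distinct symbols of N(n),
-- i.e. it is an injection Fin k → Fin n, so k ≤ n.
--
-- Identify N(n) with ℤ/nℤ and
-- put into cell (i, j) the k symbols  t + i + j  for t = 0, …, k-1. These
-- are distinct because k ≤ n, so the square is simple. For a fixed row i,
-- the t-th entries j ↦ t + i + j form a permutation of the row, so every
-- symbol appears exactly once among them; summing over the k layers t,
-- every symbol occurs exactly k times in the row. The square is symmetric,
-- so columns are balanced as well.

module Submission where

open import Defs
open import Data.Nat using (ℕ; _≥_; NonZero)
open import Data.Product using (∃; _×_)
open import Function.Bundles using (_⇔_)

open import Data.Nat using (zero; suc; _+_; _∸_; _≤_)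
open import Data.Nat.Properties using (+-comm; +-assoc; m+[n∸m]≡n; m∸n+n≡m; +-0-commutativeMonoid)
open import Data.Nat.DivMod using (_%_; m%n<n; %-distribˡ-+; m%n%n≡m%n; %-remove-+ˡ; m<n⇒m%n≡m)
open import Data.Nat.Divisibility using (∣-refl)
open import Data.Fin using (Fin; zero; suc; toℕ; fromℕ<; inject≤; _≟_)
open import Data.Fin.Properties using (toℕ-fromℕ<; fromℕ<-cong; toℕ-injective; toℕ<n; toℕ≤n; injective⇒≤; inject≤-injective)
open import Data.Fin.Permutation using (Permutation′; permutation; _⟨$⟩ʳ_; _∘ₚ_)
open import Data.Vec using (tabulate; lookup)
open import Data.Vec.Properties using (lookup∘tabulate; tabulate-cong)
open import Data.Product using (_,_)
open import Function.Base using (_∘_)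
open import Function.Bundles using (mk⇔)
open import Function.Definitions using (Injective)
open import Relation.Nullary using (yes; no)
open import Relation.Binary.PropositionalEquality using (_≡_; refl; sym; trans; cong; cong₂; module ≡-Reasoning)
open import Algebra.Properties.CommutativeMonoid.Sum +-0-commutativeMonoid
  using (sum; sum-syntax; sum-cong-≗; sum-replicate-zero; ∑-comm; ∑-permute)

-- The sum Σ[<_] of Defs is the library's sum over (ℕ, +, 0),
-- so the library's interchange and reindexing lemmas apply to it.
Σ≡sum : ∀ m (f : Fin m → ℕ) → Σ[< m ] f ≡ sum f
Σ≡sum zero    f = refl
Σ≡sum (suc m) f = cong (f zero +_) (Σ≡sum m (f ∘ suc))

Σ-cong : ∀ m {f g : Fin m → ℕ} → (∀ i → f i ≡ g i) → Σ[< m ] f ≡ Σ[< m ] g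
Σ-cong zero    eq = refl
Σ-cong (suc m) eq = cong₂ _+_ (eq zero) (Σ-cong m (eq ∘ suc))

sum-ones : ∀ k → ∑[ t < k ] 1 ≡ k
sum-ones zero    = refl
sum-ones (suc k) = cong suc (sum-ones k)

δ : ∀ {n} → Fin n → Fin n → ℕ
δ s x with s ≟ x
... | yes _ = 1
... | no  _ = 0

δ-suc : ∀ {n} (s x : Fin n) → δ (suc s) (suc x) ≡ δ s x
δ-suc s x with s ≟ x
... | yes _ = refl
... | no  _ = refl

count-tabulate : ∀ {n} k (s : Fin n) (f : Fin k → Fin n) →
  count s (tabulate f) ≡ ∑[ t < k ] δ s (f t)
count-tabulate zero    s f = refl
count-tabulate (suc k) s f with s ≟ f zero
... | yes _ = cong suc (count-tabulate k s (f ∘ suc))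
... | no  _ = count-tabulate k s (f ∘ suc)

δ-sum : ∀ n (s : Fin n) → ∑[ x < n ] δ s x ≡ 1
δ-sum (suc n) zero    = cong suc (sum-replicate-zero n)
δ-sum (suc n) (suc s) = trans (sum-cong-≗ (δ-suc s)) (δ-sum n s)

δ-permute : ∀ {n} (s : Fin n) (π : Permutation′ n) → ∑[ x < n ] δ s (π ⟨$⟩ʳ x) ≡ 1
δ-permute {n} s π = trans (sym (∑-permute (δ s) π)) (δ-sum n s)

layers-balanced : ∀ {n k} (π : Fin k → Permutation′ n) (s : Fin n) →
  Σ[< n ] (λ j → count s (tabulate (λ t → π t ⟨$⟩ʳ j))) ≡ k
layers-balanced {n} {k} π s = begin
  Σ[< n ] (λ j → count s (tabulate (λ t → π t ⟨$⟩ʳ j)))  ≡⟨ Σ≡sum n _ ⟩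
  ∑[ j < n ] count s (tabulate (λ t → π t ⟨$⟩ʳ j))      ≡⟨ sum-cong-≗ (λ j → count-tabulate k s (λ t → π t ⟨$⟩ʳ j)) ⟩
  ∑[ j < n ] ∑[ t < k ] δ s (π t ⟨$⟩ʳ j)                ≡⟨ ∑-comm (λ j t → δ s (π t ⟨$⟩ʳ j)) ⟩
  ∑[ t < k ] ∑[ j < n ] δ s (π t ⟨$⟩ʳ j)                ≡⟨ sum-cong-≗ (λ t → δ-permute s (π t)) ⟩
  ∑[ t < k ] 1                                          ≡⟨ sum-ones k ⟩
  k                                                     ∎
  where open ≡-Reasoning

symmetric-latin : ∀ {n k} (L : Array n k) → (∀ i j → L i j ≡ L j i) →
  (∀ i s → Σ[< n ] (λ j → count s (L i j)) ≡ k) → IsKLatinSquare n k L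
symmetric-latin {n} L symm rows =
  rows , λ j s → trans (Σ-cong n (λ i → cong (count s) (symm i j))) (rows j s)

module Cyclic (n : ℕ) .{{_ : NonZero n}} where

  ⟦_⟧ : ℕ → Fin n
  ⟦ m ⟧ = fromℕ< (m%n<n m n)

  ⟦⟧-cong : ∀ {a b} → a % n ≡ b % n → ⟦ a ⟧ ≡ ⟦ b ⟧
  ⟦⟧-cong eq = fromℕ<-cong _ _ eq _ _

  ⟦toℕ⟧ : ∀ (x : Fin n) → ⟦ toℕ x ⟧ ≡ x
  ⟦toℕ⟧ x = toℕ-injective (trans (toℕ-fromℕ< _) (m<n⇒m%n≡m (toℕ<n x)))

  ⟦⟧-absorb : ∀ a b → ⟦ a + toℕ ⟦ b ⟧ ⟧ ≡ ⟦ a + b ⟧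
  ⟦⟧-absorb a b = ⟦⟧-cong (begin
    (a + toℕ ⟦ b ⟧) % n        ≡⟨ cong (λ m → (a + m) % n) (toℕ-fromℕ< _) ⟩
    (a + b % n) % n            ≡⟨ %-distribˡ-+ a (b % n) n ⟩
    (a % n + b % n % n) % n    ≡⟨ cong (λ m → (a % n + m) % n) (m%n%n≡m%n b n) ⟩
    (a % n + b % n) % n        ≡⟨ %-distribˡ-+ a b n ⟨
    (a + b) % n                ∎)
    where open ≡-Reasoning

  ⟦⟧-cancel : ∀ a b (x : Fin n) → a + b ≡ n → ⟦ a + toℕ ⟦ b + toℕ x ⟧ ⟧ ≡ x
  ⟦⟧-cancel a b x a+b≡n = begin
    ⟦ a + toℕ ⟦ b + toℕ x ⟧ ⟧  ≡⟨ ⟦⟧-absorb a (b + toℕ x) ⟩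
    ⟦ a + (b + toℕ x) ⟧        ≡⟨ cong ⟦_⟧ (+-assoc a b (toℕ x)) ⟨
    ⟦ a + b + toℕ x ⟧          ≡⟨ cong (λ m → ⟦ m + toℕ x ⟧) a+b≡n ⟩
    ⟦ n + toℕ x ⟧              ≡⟨ ⟦⟧-cong (%-remove-+ˡ (toℕ x) ∣-refl) ⟩
    ⟦ toℕ x ⟧                  ≡⟨ ⟦toℕ⟧ x ⟩
    x                          ∎
    where open ≡-Reasoning

  shift : Fin n → Fin n → Fin n
  shift c x = ⟦ toℕ c + toℕ x ⟧

  unshift : Fin n → Fin n → Fin n
  unshift c s = ⟦ (n ∸ toℕ c) + toℕ s ⟧

  shift-unshift : ∀ c s → shift c (unshift c s) ≡ s
  shift-unshift c s = ⟦⟧-cancel (toℕ c) (n ∸ toℕ c) s (m+[n∸m]≡n (toℕ≤n c))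

  unshift-shift : ∀ c x → unshift c (shift c x) ≡ x
  unshift-shift c x = ⟦⟧-cancel (n ∸ toℕ c) (toℕ c) x (m∸n+n≡m (toℕ≤n c))

  shift-comm : ∀ a b → shift a b ≡ shift b a
  shift-comm a b = cong ⟦_⟧ (+-comm (toℕ a) (toℕ b))

  shift-injective : ∀ c → Injective _≡_ _≡_ (shift c)
  shift-injective c {x} {y} eq =
    trans (sym (unshift-shift c x)) (trans (cong (unshift c) eq) (unshift-shift c y))

  shiftₚ : Fin n → Permutation′ n
  shiftₚ c = permutation (shift c) (unshift c) (shift-unshift c) (unshift-shift c)

  module CyclicSquare (k : ℕ) (k≤n : k ≤ n) where

    layer : Fin k → Fin n
    layer t = inject≤ t k≤n

    square : Array n k
    square i j = tabulate (λ t → shift (layer t) (shift i j))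

    -- Row i, layer t is the permutation j ↦ t + (i + j).
    rows-balanced : ∀ i s → Σ[< n ] (λ j → count s (square i j)) ≡ k
    rows-balanced i s = layers-balanced (λ t → shiftₚ i ∘ₚ shiftₚ (layer t)) s

    square-symmetric : ∀ i j → square i j ≡ square j i
    square-symmetric i j = tabulate-cong (λ t → cong (shift (layer t)) (shift-comm i j))

    latin : IsKLatinSquare n k square
    latin = symmetric-latin square square-symmetric rows-balanced

    -- The k symbols of a cell are distinct since t ↦ t + y is injective
    -- on Fin n and the layers are distinct elements of Fin n.
    simple : IsSimple n k square
    simple i j {t} {u} eq = inject≤-injective k≤n k≤n t u (shift-injective y (begin
      shift y (layer t)      ≡⟨ shift-comm y (layer t) ⟩
      shift (layer t) y      ≡⟨ lookup∘tabulate _ t ⟨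
      lookup (square i j) t  ≡⟨ eq ⟩
      lookup (square i j) u  ≡⟨ lookup∘tabulate _ u ⟩
      shift (layer u) y      ≡⟨ shift-comm (layer u) y ⟩
      shift y (layer u)      ∎))
      where
      open ≡-Reasoning
      y : Fin n
      y = shift i j

mainTheorem6 : ∀ (n k : ℕ) → NonZero n → NonZero k →
    (∃ λ (L : Array n k) → IsKLatinSquare n k L × IsSimple n k L) ⇔ (n ≥ k)
mainTheorem6 (suc n) k _ _ = mk⇔ necessary sufficient
  where
  -- Any single simple cell injects Fin k into Fin (suc n).
  necessary : (∃ λ (L : Array (suc n) k) → IsKLatinSquare (suc n) k L × IsSimple (suc n) k L) → suc n ≥ k
  necessary (_ , _ , simple) = injective⇒≤ (simple zero zero)

  sufficient : suc n ≥ k → ∃ λ (L : Array (suc n) k) → IsKLatinSquare (suc n) k L × IsSimple (suc n) k L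
  sufficient k≤n = square , latin , simple
    where open Cyclic.CyclicSquare (suc n) k k≤n
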